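{- Let $k\ge 1$ and let $B=(X,Y,E)$ be an ACB graph. Then $bip\text{ - }dilw(B)\le k$ if and only if $B$ contains no induced subgraph isomorphic to $B_{k+1}$.
   Context: For a bipartite graph $B=(X,Y,E)$ with color classes $X,Y$: the mirror $mir(B)$ has the same color classes and $xy$ ($x\in X$, $y\in Y$) is an edge iff it is not an edge of $B$; $B$ is chordal bipartite if it has no induced chordless cycle $C_{2m}$, $m\ge3$; $B$ is ACB if both $B$ and $mir(B)$ are chordal bipartite. $\nabla_B(X)$ is the maximum number of vertices of $X$ whose neighborhoods are pairwise incomparable under set inclusion (equal neighborhoods count as comparable), $\nabla_B(Y)$ analogously, and $bip\text{ - }dilw(B)=\max(\nabla_B(X),\nabla_B(Y))$. For $m\ge 2$, $B_m$ is the bipartite graph with color classes $\{x_1,\dots,x_m\}$ and $\{y_1,\dots,y_{2m-2}\}$ in which $N(x_i)=\{y_i,\dots,y_{i+m-2}\}$ for $i=1,\dots,m$. -}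

module Defs where

open import Data.Nat using (ℕ; zero; suc; _+_; _*_; _∸_; _≤_; _≤ᵇ_)
open import Data.Fin using (Fin; toℕ)
open import Data.Bool using (Bool; true; false; not; _∧_)
open import Data.Sum using (_⊎_; inj₁; inj₂)
open import Data.Product using (Σ; _×_)
open import Data.Empty using (⊥)
open import Relation.Nullary using (¬_)
open import Relation.Binary.PropositionalEquality using (_≡_)
open import Function.Definitions using (Injective)
open import Function.Bundles using (_⇔_)

record Graph : Set₁ where
  field
    V   : Set
    Adj : V → V → Set
open Graph public

ContainsInduced : Graph → Graph → Set
ContainsInduced H G =
  Σ (V H → V G) λ φ →
    Injective _≡_ _≡_ φ × (∀ u v → (Adj H u v ⇔ Adj G (φ u) (φ v)))

-- The cycle C_n on vertices 0,…,n-1 (intended for n ≥ 3).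
CycAdj : ℕ → ℕ → ℕ → Set
CycAdj n a b = (suc a ≡ b) ⊎ (suc b ≡ a)
             ⊎ ((a ≡ 0) × (suc b ≡ n)) ⊎ ((b ≡ 0) × (suc a ≡ n))

Cycle : ℕ → Graph
Cycle n = record { V = Fin n ; Adj = λ i j → CycAdj n (toℕ i) (toℕ j) }

record BipGraph : Set where
  field
    nX : ℕ
    nY : ℕ
    E  : Fin nX → Fin nY → Bool
open BipGraph public

BAdj : (B : BipGraph) → Fin (nX B) ⊎ Fin (nY B) → Fin (nX B) ⊎ Fin (nY B) → Set
BAdj B (inj₁ x) (inj₂ y) = E B x y ≡ true
BAdj B (inj₂ y) (inj₁ x) = E B x y ≡ true
BAdj B (inj₁ _) (inj₁ _) = ⊥
BAdj B (inj₂ _) (inj₂ _) = ⊥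

graphOf : BipGraph → Graph
graphOf B = record { V = Fin (nX B) ⊎ Fin (nY B) ; Adj = BAdj B }

mir : BipGraph → BipGraph
mir B = record { nX = nX B ; nY = nY B ; E = λ x y → not (E B x y) }

ChordalBip : BipGraph → Set
ChordalBip B = ∀ m → 3 ≤ m → ¬ ContainsInduced (Cycle (2 * m)) (graphOf B)

ACB : BipGraph → Set
ACB B = ChordalBip B × ChordalBip (mir B)

NX⊆ : (B : BipGraph) → Fin (nX B) → Fin (nX B) → Set
NX⊆ B x x' = ∀ y → E B x y ≡ true → E B x' y ≡ true

NY⊆ : (B : BipGraph) → Fin (nY B) → Fin (nY B) → Set
NY⊆ B y y' = ∀ x → E B x y ≡ true → E B x y' ≡ true

IncompX : (B : BipGraph) (s : ℕ) → (Fin s → Fin (nX B)) → Set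
IncompX B s a = Injective _≡_ _≡_ a ×
  (∀ i j → ¬ (i ≡ j) → ¬ NX⊆ B (a i) (a j))

IncompY : (B : BipGraph) (s : ℕ) → (Fin s → Fin (nY B)) → Set
IncompY B s a = Injective _≡_ _≡_ a ×
  (∀ i j → ¬ (i ≡ j) → ¬ NY⊆ B (a i) (a j))

∇X≤ : BipGraph → ℕ → Set
∇X≤ B k = ∀ s (a : Fin s → Fin (nX B)) → IncompX B s a → s ≤ k

∇Y≤ : BipGraph → ℕ → Set
∇Y≤ B k = ∀ s (a : Fin s → Fin (nY B)) → IncompY B s a → s ≤ k

-- bip-dilw(B) = max(∇_B(X), ∇_B(Y)) ≤ k
BipDilw≤ : BipGraph → ℕ → Set
BipDilw≤ B k = ∇X≤ B k × ∇Y≤ B k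

-- B_m (m ≥ 2): X = {x_1..x_m}, Y = {y_1..y_{2m-2}}, N(x_i) = {y_i..y_{i+m-2}}
-- (0-indexed: x_i ~ y_j iff i ≤ j ≤ i + (m-2))

Bm : ℕ → BipGraph
Bm m = record
  { nX = m
  ; nY = 2 * m ∸ 2
  ; E  = λ i j → (toℕ i ≤ᵇ toℕ j) ∧ (toℕ j ≤ᵇ toℕ i + (m ∸ 2))
  }

-- Among pairwise incomparable vertices of X in an ACB graph, write "b between a and c" for N(a) ∩ N(c) ⊆ N(b).
-- Excluding induced hexagons and octagons in B and induced hexagons in mir B (induced 3K₂ in B) makes this
-- betweenness behave like that of a linear order: of any three vertices one lies between the other two, and the
-- four-point laws of a line hold. Inserting the vertices one at a time therefore arranges any k + 1 of them as
-- x₀, …, x_k so that every neighbourhood meets the sequence in an interval. Each proper prefix and each proper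
-- suffix is then cut out by some neighbour, and these 2k neighbours together with x₀, …, x_k induce B_{k+1}.
-- Conversely, the X-vertices of B_{k+1} are pairwise incomparable and an induced copy keeps them so; for k ≥ 2
-- they all share neighbours with x₁ and so land in one colour class of B, and for k = 1, where B₂ = 2K₂, one
-- endpoint of each of the two edges is taken.
module Submission where

open import Defs
open import Data.Nat using (ℕ; zero; suc; _+_; _*_; _∸_; _≤_; _<_; z≤n; s≤s; _≤?_; _<?_; _≟_)
import Data.Nat.Properties as ℕ
open import Data.Fin as Fin using (Fin; zero; suc; toℕ; fromℕ; fromℕ<; inject₁; inject≤; punchIn; punchOut)
open import Data.Fin.Properties
  using (toℕ-injective; toℕ<n; toℕ-fromℕ; toℕ-fromℕ<; toℕ-inject; toℕ-inject₁; inject≤-injective;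
         suc-injective; ≤fromℕ; ≤∧≢⇒<; ≤̄⇒inject₁<; <⇒≢; punchIn-punchOut; ¬∀⟶∃¬; ¬∀⟶∃¬-smallest; all?)
open import Data.Bool using (Bool; true; false; not)
open import Data.Bool.Properties using (T-≡; T-∧; ¬-not; not-¬) renaming (_≟_ to _≟ᵇ_)
open import Data.Vec.Functional using (Vector; insertAt)
open import Data.Vec.Functional.Properties using (insertAt-lookup; insertAt-punchIn)
open import Data.Sum as Sum using (_⊎_; inj₁; inj₂; swap)
open import Data.Sum.Properties using (swap-involutive; ≡-dec)
open import Data.Product using (Σ; _×_; _,_; proj₁; proj₂)
open import Data.Empty using (⊥; ⊥-elim)
open import Relation.Nullary using (¬_; Dec; yes; no)
open import Relation.Nullary.Decidable using (isYes; _⊎-dec_; _×-dec_; _→-dec_)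
open import Relation.Binary.Definitions using (DecidableEquality; tri<; tri≈; tri>)
open import Relation.Binary.PropositionalEquality using (_≡_; refl; sym; trans; cong; subst; subst₂)
open import Function.Base using (_∘_; const)
open import Function.Definitions using (Injective)
open import Function.Bundles using (_⇔_; mk⇔; Equivalence)
open import Function.Construct.Identity using (⇔-id)
open import Function.Construct.Symmetry using (⇔-sym)
open import Function.Construct.Composition using (_⇔-∘_)

≡isYes⇒⇔ : ∀ {A : Set} {b : Bool} (d : Dec A) → b ≡ isYes d → (b ≡ true ⇔ A)
≡isYes⇒⇔ (yes a) refl = mk⇔ (const a) (const refl)
≡isYes⇒⇔ (no ¬a) refl = mk⇔ (λ ()) (λ a → ⊥-elim (¬a a))

¬→-witness : ∀ {p : Bool} {Q : Set} → ¬ (p ≡ true → Q) → p ≡ true × ¬ Q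
¬→-witness {true} ¬p→Q = refl , λ q → ¬p→Q λ _ → q
¬→-witness {false} ¬p→Q = ⊥-elim (¬p→Q λ ())

≤⇒≡⊎< : ∀ {n} {i j : Fin n} → i Fin.≤ j → i ≡ j ⊎ i Fin.< j
≤⇒≡⊎< {i = i} {j} i≤j with i Fin.≟ j
... | yes i≡j = inj₁ i≡j
... | no i≢j = inj₂ (≤∧≢⇒< i≤j i≢j)

TwinFree : Graph → Set
TwinFree H = ∀ u v → (∀ w → Adj H u w ⇔ Adj H v w) → u ≡ v

Separated : (H : Graph) → V H → V H → Set
Separated H u v = Σ (V H) λ w → (Adj H u w × ¬ Adj H v w) ⊎ (¬ Adj H u w × Adj H v w)

separated-sym : ∀ {H u v} → Separated H u v → Separated H v u
separated-sym (w , inj₁ (uw , ¬vw)) = w , inj₂ (¬vw , uw)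
separated-sym (w , inj₂ (¬uw , vw)) = w , inj₁ (vw , ¬uw)

separating⇒twinFree : ∀ {H} → DecidableEquality (V H) → (∀ {u v} → ¬ u ≡ v → Separated H u v) → TwinFree H
separating⇒twinFree _≟ᵥ_ separated u v same with u ≟ᵥ v
... | yes u≡v = u≡v
... | no u≢v with separated u≢v
...   | w , inj₁ (uw , ¬vw) = ⊥-elim (¬vw (Equivalence.to (same w) uw))
...   | w , inj₂ (¬uw , vw) = ⊥-elim (¬uw (Equivalence.from (same w) vw))

reflecting⇒containsInduced : ∀ {H G} → TwinFree H → (φ : V H → V G) →
  (∀ u v → Adj H u v ⇔ Adj G (φ u) (φ v)) → ContainsInduced H G
reflecting⇒containsInduced {H} {G} twinFree φ reflect = φ , injective , reflect
  where
  transport : ∀ {u v} → φ u ≡ φ v → ∀ w → Adj H u w → Adj H v w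
  transport {u} {v} φu≡φv w uw =
    Equivalence.from (reflect v w) (subst (λ t → Adj G t (φ w)) φu≡φv (Equivalence.to (reflect u w) uw))
  injective : Injective _≡_ _≡_ φ
  injective φu≡φv = twinFree _ _ λ w → mk⇔ (transport φu≡φv w) (transport (sym φu≡φv) w)

-- Induced cycles

cycAdj? : ∀ n a b → Dec (CycAdj n a b)
cycAdj? n a b = (suc a ≟ b) ⊎-dec (suc b ≟ a) ⊎-dec (a ≟ 0 ×-dec suc b ≟ n) ⊎-dec (b ≟ 0 ×-dec suc a ≟ n)

CycAdj-sym : ∀ {n a b} → CycAdj n a b → CycAdj n b a
CycAdj-sym (inj₁ e) = inj₂ (inj₁ e)
CycAdj-sym (inj₂ (inj₁ e)) = inj₁ e
CycAdj-sym (inj₂ (inj₂ (inj₁ e))) = inj₂ (inj₂ (inj₂ e))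
CycAdj-sym (inj₂ (inj₂ (inj₂ e))) = inj₂ (inj₂ (inj₁ e))

private
  next-but-one : ∀ {n a b} → a < b → CycAdj n b (suc a) → b ≡ suc (suc a)
  next-but-one a<b (inj₁ refl) = ⊥-elim (ℕ.<-irrefl refl a<b)
  next-but-one a<b (inj₂ (inj₁ e)) = sym e
  next-but-one a<b (inj₂ (inj₂ (inj₁ (refl , _)))) = ⊥-elim (ℕ.n≮0 a<b)

  ¬CycAdj-+3 : ∀ {n a} → 5 ≤ n → ¬ CycAdj n a (3 + a)
  ¬CycAdj-+3 {a = a} _ (inj₁ e) = ℕ.<-irrefl e (s≤s (s≤s (ℕ.n≤1+n a)))
  ¬CycAdj-+3 {a = a} _ (inj₂ (inj₁ e)) = ℕ.<-irrefl (sym e) (ℕ.m<n+m a (s≤s z≤n))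
  ¬CycAdj-+3 (s≤s (s≤s (s≤s (s≤s (s≤s _))))) (inj₂ (inj₂ (inj₁ (refl , ()))))

  ¬CycAdj-0 : ∀ {n a} → 5 ≤ n → 3 + a ≡ n → ¬ CycAdj n a 0
  ¬CycAdj-0 (s≤s (s≤s (s≤s (s≤s (s≤s _))))) refl (inj₂ (inj₁ ()))
  ¬CycAdj-0 {a = a} _ refl (inj₂ (inj₂ (inj₂ (_ , e)))) = ℕ.<-irrefl e (s≤s (s≤s (ℕ.n≤1+n a)))

  -- a twin b > a of a is adjacent to a + 1, hence b = a + 2; then b + 1 (or 0, if b is last) tells them apart
  no-twins : ∀ {n a b} → 5 ≤ n → a < b → b < n →
    (∀ w → w < n → CycAdj n a w → CycAdj n b w) → (∀ w → w < n → CycAdj n b w → CycAdj n a w) → ⊥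
  no-twins {n} {a} 5≤n a<b b<n to from
    with refl ← next-but-one a<b (to (suc a) (ℕ.≤-<-trans a<b b<n) (inj₁ refl))
    with ℕ.m≤n⇒m<n∨m≡n b<n
  ... | inj₁ 3+a<n = ¬CycAdj-+3 5≤n (from (3 + a) 3+a<n (inj₁ refl))
  ... | inj₂ 3+a≡n =
    ¬CycAdj-0 5≤n 3+a≡n (from 0 (ℕ.<-trans (s≤s z≤n) b<n) (inj₂ (inj₂ (inj₂ (refl , 3+a≡n)))))

  atℕ : ∀ {n} {P : ℕ → Set} → (∀ (w : Fin n) → P (toℕ w)) → ∀ w → w < n → P w
  atℕ {P = P} f w w<n = subst P (toℕ-fromℕ< w<n) (f (fromℕ< w<n))

cycle-twinFree : ∀ {n} → 5 ≤ n → TwinFree (Cycle n)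
cycle-twinFree 5≤n u v same with ℕ.<-cmp (toℕ u) (toℕ v)
... | tri< u<v _ _ =
  ⊥-elim (no-twins 5≤n u<v (toℕ<n v) (atℕ (Equivalence.to ∘ same)) (atℕ (Equivalence.from ∘ same)))
... | tri≈ _ u≡v _ = toℕ-injective u≡v
... | tri> _ _ v<u =
  ⊥-elim (no-twins 5≤n v<u (toℕ<n u) (atℕ (Equivalence.from ∘ same)) (atℕ (Equivalence.to ∘ same)))

data Alternating (m : ℕ) : ℕ → Set where
  even : (i : Fin m) → Alternating m (2 * toℕ i)
  odd  : (i : Fin m) → Alternating m (suc (2 * toℕ i))

private
  alternating-suc : ∀ {m p} → Alternating m p → Alternating (suc m) (suc (suc p))
  alternating-suc (even i) = subst (Alternating _) (ℕ.*-suc 2 (toℕ i)) (even (suc i))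
  alternating-suc (odd i) = subst (Alternating _) (cong suc (ℕ.*-suc 2 (toℕ i))) (odd (suc i))

alternating : ∀ m p → p < 2 * m → Alternating m p
alternating (suc m) zero _ = even zero
alternating (suc m) (suc zero) _ = odd zero
alternating (suc m) (suc (suc p)) p+2<2m+2 =
  alternating-suc (alternating m p (ℕ.≤-pred (ℕ.≤-pred (subst (suc (suc p) <_) (ℕ.*-suc 2 m) p+2<2m+2))))

¬CycAdj-even : ∀ m a b → ¬ CycAdj (2 * m) (2 * a) (2 * b)
¬CycAdj-even m a b (inj₁ e) = ℕ.even≢odd b a (sym e)
¬CycAdj-even m a b (inj₂ (inj₁ e)) = ℕ.even≢odd a b (sym e)
¬CycAdj-even m a b (inj₂ (inj₂ (inj₁ (_ , e)))) = ℕ.even≢odd m b (sym e)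
¬CycAdj-even m a b (inj₂ (inj₂ (inj₂ (_ , e)))) = ℕ.even≢odd m a (sym e)

¬CycAdj-odd : ∀ m a b → ¬ CycAdj (2 * m) (suc (2 * a)) (suc (2 * b))
¬CycAdj-odd m a b (inj₁ e) = ℕ.even≢odd b a (sym (ℕ.suc-injective e))
¬CycAdj-odd m a b (inj₂ (inj₁ e)) = ℕ.even≢odd a b (sym (ℕ.suc-injective e))
¬CycAdj-odd m a b (inj₂ (inj₂ (inj₁ (() , _))))
¬CycAdj-odd m a b (inj₂ (inj₂ (inj₂ (() , _))))

-- x i and y j are the vertices 2i and 2j + 1 of the cycle C_{2m}
InducedCycle : (B : BipGraph) (m : ℕ) → (Fin m → Fin (nX B)) → (Fin m → Fin (nY B)) → Set
InducedCycle B m x y = ∀ i j → E B (x i) (y j) ≡ isYes (cycAdj? (2 * m) (2 * toℕ i) (suc (2 * toℕ j)))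

inducedCycle⇒containsInduced : ∀ {B m x y} → 3 ≤ m → InducedCycle B m x y →
  ContainsInduced (Cycle (2 * m)) (graphOf B)
inducedCycle⇒containsInduced {B} {m} {x} {y} 3≤m rungs =
  reflecting⇒containsInduced {G = graphOf B} (cycle-twinFree (ℕ.≤-trans (ℕ.n≤1+n 5) (ℕ.*-monoʳ-≤ 2 3≤m)))
    (vertex ∘ position) (λ p q → vertex-adj (position p) (position q))
  where
  position : (p : Fin (2 * m)) → Alternating m (toℕ p)
  position p = alternating m (toℕ p) (toℕ<n p)
  vertex : ∀ {p} → Alternating m p → Fin (nX B) ⊎ Fin (nY B)
  vertex (even i) = inj₁ (x i)
  vertex (odd j) = inj₂ (y j)
  rung : ∀ i j → E B (x i) (y j) ≡ true ⇔ CycAdj (2 * m) (2 * toℕ i) (suc (2 * toℕ j))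
  rung i j = ≡isYes⇒⇔ (cycAdj? _ _ _) (rungs i j)
  vertex-adj : ∀ {p q} (vp : Alternating m p) (vq : Alternating m q) →
    CycAdj (2 * m) p q ⇔ BAdj B (vertex vp) (vertex vq)
  vertex-adj (even i) (even i′) = mk⇔ (¬CycAdj-even m (toℕ i) (toℕ i′)) λ ()
  vertex-adj (even i) (odd j) = ⇔-sym (rung i j)
  vertex-adj (odd j) (even i) =
    mk⇔ (Equivalence.from (rung i j) ∘ CycAdj-sym) (CycAdj-sym ∘ Equivalence.to (rung i j))
  vertex-adj (odd j) (odd j′) = mk⇔ (¬CycAdj-odd m (toℕ j) (toℕ j′)) λ ()

hexagon : ∀ {B} (a b c : Fin (nX B)) (u v w : Fin (nY B)) →
  E B a u ≡ true → E B b u ≡ true → E B c u ≡ false →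
  E B b v ≡ true → E B c v ≡ true → E B a v ≡ false →
  E B c w ≡ true → E B a w ≡ true → E B b w ≡ false →
  ContainsInduced (Cycle (2 * 3)) (graphOf B)
hexagon {B} a b c u v w au bu cu bv cv av cw aw bw = inducedCycle⇒containsInduced (s≤s (s≤s (s≤s z≤n))) rungs
  where
  x : Fin 3 → Fin (nX B)
  x zero = a
  x (suc zero) = b
  x (suc (suc zero)) = c
  y : Fin 3 → Fin (nY B)
  y zero = u
  y (suc zero) = v
  y (suc (suc zero)) = w
  rungs : InducedCycle B 3 x y
  rungs zero zero = au
  rungs zero (suc zero) = av
  rungs zero (suc (suc zero)) = aw
  rungs (suc zero) zero = bu
  rungs (suc zero) (suc zero) = bv
  rungs (suc zero) (suc (suc zero)) = bw
  rungs (suc (suc zero)) zero = cu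
  rungs (suc (suc zero)) (suc zero) = cv
  rungs (suc (suc zero)) (suc (suc zero)) = cw

octagon : ∀ {B} (a b c d : Fin (nX B)) (u v w t : Fin (nY B)) →
  E B a u ≡ true → E B b u ≡ true → E B c u ≡ false → E B d u ≡ false →
  E B b v ≡ true → E B c v ≡ true → E B a v ≡ false → E B d v ≡ false →
  E B c w ≡ true → E B d w ≡ true → E B a w ≡ false → E B b w ≡ false →
  E B d t ≡ true → E B a t ≡ true → E B b t ≡ false → E B c t ≡ false →
  ContainsInduced (Cycle (2 * 4)) (graphOf B)
octagon {B} a b c d u v w t au bu cu du bv cv av dv cw dw aw bw dt at bt ct =
  inducedCycle⇒containsInduced (s≤s (s≤s (s≤s z≤n))) rungs
  where
  x : Fin 4 → Fin (nX B)
  x zero = a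
  x (suc zero) = b
  x (suc (suc zero)) = c
  x (suc (suc (suc zero))) = d
  y : Fin 4 → Fin (nY B)
  y zero = u
  y (suc zero) = v
  y (suc (suc zero)) = w
  y (suc (suc (suc zero))) = t
  rungs : InducedCycle B 4 x y
  rungs zero zero = au
  rungs zero (suc zero) = av
  rungs zero (suc (suc zero)) = aw
  rungs zero (suc (suc (suc zero))) = at
  rungs (suc zero) zero = bu
  rungs (suc zero) (suc zero) = bv
  rungs (suc zero) (suc (suc zero)) = bw
  rungs (suc zero) (suc (suc (suc zero))) = bt
  rungs (suc (suc zero)) zero = cu
  rungs (suc (suc zero)) (suc zero) = cv
  rungs (suc (suc zero)) (suc (suc zero)) = cw
  rungs (suc (suc zero)) (suc (suc (suc zero))) = ct
  rungs (suc (suc (suc zero))) zero = du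
  rungs (suc (suc (suc zero))) (suc zero) = dv
  rungs (suc (suc (suc zero))) (suc (suc zero)) = dw
  rungs (suc (suc (suc zero))) (suc (suc (suc zero))) = dt

transpose : BipGraph → BipGraph
transpose B = record { nX = nY B ; nY = nX B ; E = λ y x → E B x y }

transpose-adj : ∀ B u v → BAdj (transpose B) u v ⇔ BAdj B (swap u) (swap v)
transpose-adj B (inj₁ _) (inj₁ _) = ⇔-id _
transpose-adj B (inj₁ _) (inj₂ _) = ⇔-id _
transpose-adj B (inj₂ _) (inj₁ _) = ⇔-id _
transpose-adj B (inj₂ _) (inj₂ _) = ⇔-id _

containsInduced-transpose : ∀ {H} B → ContainsInduced H (graphOf (transpose B)) → ContainsInduced H (graphOf B)
containsInduced-transpose B (φ , injective , reflect) =
  swap ∘ φ ,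
  (λ {u} {v} e → injective (trans (sym (swap-involutive (φ u))) (trans (cong swap e) (swap-involutive (φ v))))) ,
  λ u v → transpose-adj B (φ u) (φ v) ⇔-∘ reflect u v

chordal-transpose : ∀ B → ChordalBip B → ChordalBip (transpose B)
chordal-transpose B chordal m 3≤m = chordal m 3≤m ∘ containsInduced-transpose B

Pairwise : ∀ {A : Set} {n} → (A → A → Set) → Vector A n → Set
Pairwise R σ = ∀ {i j} → ¬ i ≡ j → R (σ i) (σ j)

punchIn-cancel-< : ∀ {n} (g : Fin (suc n)) r r′ → punchIn g r Fin.< punchIn g r′ → r Fin.< r′
punchIn-cancel-< zero r r′ (s≤s r<r′) = r<r′
punchIn-cancel-< (suc g) zero (suc r′) _ = s≤s z≤n
punchIn-cancel-< (suc g) (suc r) (suc r′) (s≤s r<r′) = s≤s (punchIn-cancel-< g r r′ r<r′)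

punchIn<⇒< : ∀ {n} (g : Fin (suc n)) r → punchIn g r Fin.< g → r Fin.< g
punchIn<⇒< (suc g) zero _ = s≤s z≤n
punchIn<⇒< (suc g) (suc r) (s≤s r<g) = s≤s (punchIn<⇒< g r r<g)

<punchIn⇒≤ : ∀ {n} (g : Fin (suc n)) r → g Fin.< punchIn g r → g Fin.≤ r
<punchIn⇒≤ zero r _ = z≤n
<punchIn⇒≤ (suc g) (suc r) (s≤s g<r) = s≤s (<punchIn⇒≤ g r g<r)

data Inserted {n} (g : Fin (suc n)) : Fin (suc n) → Set where
  new : Inserted g g
  old : ∀ r → Inserted g (punchIn g r)

inserted : ∀ {n} (g p : Fin (suc n)) → Inserted g p
inserted g p with g Fin.≟ p
... | yes refl = new
... | no g≢p = subst (Inserted g) (punchIn-punchOut g≢p) (old (punchOut g≢p))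

insertAt-pairwise : ∀ {A : Set} {n} {R : A → A → Set} {σ : Vector A n} {z} g →
  Pairwise R σ → (∀ i → R z (σ i)) → (∀ i → R (σ i) z) → Pairwise R (insertAt σ g z)
insertAt-pairwise {σ = σ} {z} g Rσ Rzσ Rσz {p} {q} p≢q with inserted g p | inserted g q
... | new | new = ⊥-elim (p≢q refl)
... | new | old r rewrite insertAt-lookup σ g z | insertAt-punchIn σ g z r = Rzσ r
... | old r | new rewrite insertAt-lookup σ g z | insertAt-punchIn σ g z r = Rσz r
... | old r | old r′ rewrite insertAt-punchIn σ g z r | insertAt-punchIn σ g z r′ =
  Rσ λ r≡r′ → p≢q (cong (punchIn g) r≡r′)

module _ {A : Set} (T : A → A → A → Set) where

  Ordered : ∀ {n} → Vector A n → Set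
  Ordered σ = ∀ {i j l} → i Fin.< j → j Fin.< l → T (σ i) (σ j) (σ l)

  ordered-short : ∀ {n} {σ : Vector A n} → n ≤ 2 → Ordered σ
  ordered-short {σ = σ} n≤2 {i} {j} {l} i<j j<l =
    ⊥-elim (ℕ.<-irrefl refl (ℕ.<-≤-trans (toℕ<n l) (ℕ.≤-trans n≤2 2≤l)))
    where
    2≤l : 2 ≤ toℕ l
    2≤l = ℕ.≤-trans (s≤s (ℕ.≤-trans (s≤s z≤n) i<j)) j<l

  record Fits {n} (σ : Vector A n) (g : Fin (suc n)) (z : A) : Set where
    field
      before : ∀ {i l} → i Fin.< l → l Fin.< g → T (σ i) (σ l) z
      across : ∀ {i l} → i Fin.< g → g Fin.≤ l → T (σ i) z (σ l)
      after  : ∀ {i l} → g Fin.≤ i → i Fin.< l → T z (σ i) (σ l)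

  ordered-insertAt : ∀ {n} {σ : Vector A n} {g z} → Ordered σ → Fits σ g z → Ordered (insertAt σ g z)
  ordered-insertAt {σ = σ} {g} {z} ordered fits {p} {q} {l} p<q q<l
    with inserted g p | inserted g q | inserted g l
  ... | new | new | _ = ⊥-elim (ℕ.<-irrefl refl p<q)
  ... | _ | new | new = ⊥-elim (ℕ.<-irrefl refl q<l)
  ... | new | old _ | new = ⊥-elim (ℕ.<-irrefl refl (ℕ.<-trans p<q q<l))
  ... | new | old r | old r′ rewrite insertAt-lookup σ g z | insertAt-punchIn σ g z r | insertAt-punchIn σ g z r′ =
    Fits.after fits (<punchIn⇒≤ g r p<q) (punchIn-cancel-< g r r′ q<l)
  ... | old r | new | old r′ rewrite insertAt-lookup σ g z | insertAt-punchIn σ g z r | insertAt-punchIn σ g z r′ =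
    Fits.across fits (punchIn<⇒< g r p<q) (<punchIn⇒≤ g r′ q<l)
  ... | old r | old r′ | new rewrite insertAt-lookup σ g z | insertAt-punchIn σ g z r | insertAt-punchIn σ g z r′ =
    Fits.before fits (punchIn-cancel-< g r r′ p<q) (punchIn<⇒< g r′ q<l)
  ... | old r | old r′ | old r″
    rewrite insertAt-punchIn σ g z r | insertAt-punchIn σ g z r′ | insertAt-punchIn σ g z r″ =
    ordered (punchIn-cancel-< g r r′ p<q) (punchIn-cancel-< g r′ r″ q<l)

-- The graphs B_m

Window : ℕ → ℕ → ℕ → Set
Window w i J = i ≤ J × J ≤ i + w

E-Bm⇔ : ∀ m i j → E (Bm m) i j ≡ true ⇔ Window (m ∸ 2) (toℕ i) (toℕ j)
E-Bm⇔ m i j = mk⇔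
  (λ e → let i≤j , j≤i+w = Equivalence.to T-∧ (Equivalence.from T-≡ e)
         in ℕ.≤ᵇ⇒≤ _ _ i≤j , ℕ.≤ᵇ⇒≤ _ _ j≤i+w)
  (λ (i≤j , j≤i+w) → Equivalence.to T-≡ (Equivalence.from T-∧ (ℕ.≤⇒≤ᵇ i≤j , ℕ.≤⇒≤ᵇ j≤i+w)))

data Cut (k : ℕ) : ℕ → Set where
  below : ∀ {J} → J ≤ k → Cut k J
  above : ∀ s → Cut k (suc (k + s))

cut : ∀ k J → Cut k J
cut k zero = below z≤n
cut zero (suc J) = above J
cut (suc k) (suc J) with cut k J
... | below J≤k = below (s≤s J≤k)
... | above s = above s

nY-Bm : ∀ w → nY (Bm (suc (suc w))) ≡ suc w + suc w
nY-Bm w = trans (ℕ.+-suc w _) (cong (λ v → suc (w + suc v)) (ℕ.+-identityʳ w))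

Bm-index : ∀ w {J} → J ≤ suc w + w → J < nY (Bm (suc (suc w)))
Bm-index w {J} J≤ = subst (J <_) (sym (trans (nY-Bm w) (cong suc (ℕ.+-suc w w)))) (s≤s J≤)

Bm-index-above : ∀ w {s} → suc (w + s) < nY (Bm (suc (suc w))) → s ≤ w
Bm-index-above w {s} w+s<N = ℕ.≤-pred (ℕ.+-cancelˡ-≤ w (suc s) (suc w)
  (subst (_≤ w + suc w) (sym (ℕ.+-suc w s)) (ℕ.≤-pred (subst (suc (suc (w + s)) ≤_) (nY-Bm w) w+s<N))))

module _ (w : ℕ) where

  private
    m N : ℕ
    m = suc (suc w)
    N = nY (Bm m)

  Bm-adj⇔ : ∀ (i : Fin m) {J} (J<N : J < N) → BAdj (Bm m) (inj₁ i) (inj₂ (fromℕ< J<N)) ⇔ Window w (toℕ i) J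
  Bm-adj⇔ i {J} J<N =
    subst (λ v → E (Bm m) i (fromℕ< J<N) ≡ true ⇔ Window w (toℕ i) v) (toℕ-fromℕ< J<N)
      (E-Bm⇔ m i (fromℕ< J<N))

  Bm-adj⇔′ : ∀ {i} (i<m : i < m) (j : Fin N) → BAdj (Bm m) (inj₂ j) (inj₁ (fromℕ< i<m)) ⇔ Window w i (toℕ j)
  Bm-adj⇔′ {i} i<m j =
    subst (λ v → E (Bm m) (fromℕ< i<m) j ≡ true ⇔ Window w v (toℕ j)) (toℕ-fromℕ< i<m)
      (E-Bm⇔ m (fromℕ< i<m) j)

  private
    column<N : ∀ (i : Fin m) → toℕ i < N
    column<N i = Bm-index w (ℕ.≤-trans (ℕ.≤-pred (toℕ<n i)) (ℕ.m≤m+n (suc w) w))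

    on-column : ∀ i → BAdj (Bm m) (inj₁ i) (inj₂ (fromℕ< (column<N i)))
    on-column i = Equivalence.from (Bm-adj⇔ i (column<N i)) (ℕ.≤-refl , ℕ.m≤m+n _ w)

    window-separating : ∀ {J J′} → J < J′ → J′ < N → Σ ℕ λ i → i < m ×
      ((Window w i J × ¬ Window w i J′) ⊎ (¬ Window w i J × Window w i J′))
    window-separating {J} {J′} J<J′ J′<N with cut w J′
    ... | below J′≤w = J′ , s≤s (ℕ.m≤n⇒m≤1+n J′≤w) ,
                       inj₂ ((λ (J′≤J , _) → ℕ.<⇒≱ J<J′ J′≤J) , ℕ.≤-refl , ℕ.m≤m+n J′ w)
    ... | above i with i ≤? J
    ...   | yes i≤J = i , s≤s (ℕ.m≤n⇒m≤1+n (Bm-index-above w J′<N)) ,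
                      inj₁ ((i≤J , subst (J ≤_) (ℕ.+-comm w i) (ℕ.≤-pred J<J′)) ,
                            λ (_ , J′≤i+w) → ℕ.<-irrefl (ℕ.+-comm w i) J′≤i+w)
    ...   | no i≰J = J , s≤s (ℕ.m≤n⇒m≤1+n (ℕ.<⇒≤ (ℕ.<-≤-trans J<i (Bm-index-above w J′<N)))) ,
                     inj₁ ((ℕ.≤-refl , ℕ.m≤m+n J w) ,
                           λ (_ , J′≤J+w) →
                             ℕ.<-asym (subst (J + w <_) (ℕ.+-comm i w) (ℕ.+-monoˡ-< w J<i)) J′≤J+w)
      where
      J<i : J < i
      J<i = ℕ.≰⇒> i≰J

    columns-separated : ∀ {j j′ : Fin N} → toℕ j < toℕ j′ → Separated (graphOf (Bm m)) (inj₂ j) (inj₂ j′)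
    columns-separated {j} {j′} j<j′ with i , i<m , windows ← window-separating j<j′ (toℕ<n j′) =
      inj₁ (fromℕ< i<m) , Sum.map
        (λ (in-j , ¬in-j′) →
          Equivalence.from (Bm-adj⇔′ i<m j) in-j , ¬in-j′ ∘ Equivalence.to (Bm-adj⇔′ i<m j′))
        (λ (¬in-j , in-j′) →
          ¬in-j ∘ Equivalence.to (Bm-adj⇔′ i<m j) , Equivalence.from (Bm-adj⇔′ i<m j′) in-j′)
        windows

  Bm-x-separated : ∀ {i j : Fin m} → ¬ i ≡ j →
    Σ (Fin m ⊎ Fin N) λ v → BAdj (Bm m) (inj₁ i) v × ¬ BAdj (Bm m) (inj₁ j) v
  Bm-x-separated {i} {j} i≢j with ℕ.<-cmp (toℕ i) (toℕ j)
  ... | tri≈ _ i≡j _ = ⊥-elim (i≢j (toℕ-injective i≡j))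
  ... | tri< i<j _ _ = inj₂ (fromℕ< (column<N i)) , on-column i ,
                       λ adj → ℕ.<⇒≱ i<j (proj₁ (Equivalence.to (Bm-adj⇔ j (column<N i)) adj))
  ... | tri> _ _ j<i = inj₂ (fromℕ< i+w<N) , Equivalence.from (Bm-adj⇔ i i+w<N) (ℕ.m≤m+n _ w , ℕ.≤-refl) ,
                       λ adj → ℕ.<⇒≱ j<i (ℕ.+-cancelʳ-≤ w _ _ (proj₂ (Equivalence.to (Bm-adj⇔ j i+w<N) adj)))
    where
    i+w<N : toℕ i + w < N
    i+w<N = Bm-index w (ℕ.+-monoˡ-≤ w (ℕ.≤-pred (toℕ<n i)))

  Bm-twinFree : TwinFree (graphOf (Bm m))
  Bm-twinFree = separating⇒twinFree (≡-dec Fin._≟_ Fin._≟_) separated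
    where
    separated : ∀ {u v} → ¬ u ≡ v → Separated (graphOf (Bm m)) u v
    separated {inj₁ i} {inj₁ j} i≢j with v , iv , ¬jv ← Bm-x-separated (i≢j ∘ cong inj₁) = v , inj₁ (iv , ¬jv)
    separated {inj₁ i} {inj₂ _} _ = inj₂ (fromℕ< (column<N i)) , inj₁ (on-column i , λ ())
    separated {inj₂ _} {inj₁ i} _ = inj₂ (fromℕ< (column<N i)) , inj₂ ((λ ()) , on-column i)
    separated {inj₂ j} {inj₂ j′} j≢j′ with ℕ.<-cmp (toℕ j) (toℕ j′)
    ... | tri< j<j′ _ _ = columns-separated j<j′
    ... | tri≈ _ j≡j′ _ = ⊥-elim (j≢j′ (cong inj₂ (toℕ-injective j≡j′)))
    ... | tri> _ _ j′<j = separated-sym {graphOf (Bm m)} (columns-separated j′<j)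

  Bm-linked : 1 ≤ w → ∀ (i : Fin m) →
    Σ (Fin m ⊎ Fin N) λ v → BAdj (Bm m) (inj₁ (suc zero)) v × BAdj (Bm m) (inj₁ i) v
  Bm-linked 1≤w zero = inj₂ (fromℕ< 1<N) ,
    Equivalence.from (Bm-adj⇔ (suc zero) 1<N) (ℕ.≤-refl , ℕ.m≤m+n 1 w) ,
    Equivalence.from (Bm-adj⇔ zero 1<N) (z≤n , 1≤w)
    where
    1<N : 1 < N
    1<N = Bm-index w (s≤s z≤n)
  Bm-linked 1≤w (suc i) = inj₂ (fromℕ< w+1<N) ,
    Equivalence.from (Bm-adj⇔ (suc zero) w+1<N) (s≤s z≤n , ℕ.≤-refl) ,
    Equivalence.from (Bm-adj⇔ (suc i) w+1<N) (s≤s (ℕ.≤-pred (toℕ<n i)) , s≤s (ℕ.m≤n+m w (toℕ i)))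
    where
    w+1<N : suc w < N
    w+1<N = Bm-index w (ℕ.m≤m+n (suc w) w)

-- Betweenness in ACB graphs

module Neighbourhoods (B : BipGraph) where

  X Y : Set
  X = Fin (nX B)
  Y = Fin (nY B)

  _∈_ _∉_ : X → Y → Set
  x ∈ y = E B x y ≡ true
  x ∉ y = E B x y ≡ false

  ∈∉-clash : ∀ {x y} → x ∈ y → x ∉ y → ⊥
  ∈∉-clash x∈y x∉y = not-¬ x∈y x∉y

  _⊈_ _∥_ : X → X → Set
  a ⊈ b = ¬ NX⊆ B a b
  a ∥ b = a ⊈ b × b ⊈ a

  ∥-sym : ∀ {a b} → a ∥ b → b ∥ a
  ∥-sym (a⊈b , b⊈a) = b⊈a , a⊈b

  private-neighbour : ∀ {a b} → a ⊈ b → Σ Y λ y → a ∈ y × b ∉ y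
  private-neighbour {a} {b} a⊈b
    with y , fails ← ¬∀⟶∃¬ (nY B) _ (λ y → (E B a y ≟ᵇ true) →-dec (E B b y ≟ᵇ true)) a⊈b
    with a∈y , b∉y ← ¬→-witness fails
    = y , a∈y , ¬-not b∉y

  Between : X → X → X → Set
  Between a b c = ∀ y → a ∈ y → c ∈ y → b ∈ y

  between? : ∀ a b c → Dec (Between a b c)
  between? a b c = all? λ y → (E B a y ≟ᵇ true) →-dec (E B c y ≟ᵇ true) →-dec (E B b y ≟ᵇ true)

  ¬between-witness : ∀ {a b c} → ¬ Between a b c → Σ Y λ y → a ∈ y × c ∈ y × b ∉ y
  ¬between-witness {a} {b} {c} ¬abc
    with y , fails ← ¬∀⟶∃¬ (nY B) _
                       (λ y → (E B a y ≟ᵇ true) →-dec (E B c y ≟ᵇ true) →-dec (E B b y ≟ᵇ true)) ¬abc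
    with a∈y , fails′ ← ¬→-witness fails
    with c∈y , b∉y ← ¬→-witness fails′
    = y , a∈y , c∈y , ¬-not b∉y

  between-sym : ∀ {a b c} → Between a b c → Between c b a
  between-sym abc y c∈y a∈y = abc y a∈y c∈y

  between-∉ : ∀ {a b c y} → Between a b c → a ∈ y → b ∉ y → c ∉ y
  between-∉ {y = y} abc a∈y b∉y = ¬-not λ c∈y → ∈∉-clash (abc y a∈y c∈y) b∉y

  between-trans : ∀ {a b c d} → Between a b c → Between a c d → Between a b d
  between-trans abc acd y a∈y d∈y = abc y a∈y (acd y a∈y d∈y)

module ChordalBetweenness (B : BipGraph) (chordal : ChordalBip B) (mirror-chordal : ChordalBip (mir B)) where

  open Neighbourhoods B

  private
    3≤3+ : ∀ {n} → 3 ≤ 3 + n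
    3≤3+ = s≤s (s≤s (s≤s z≤n))

  no-hexagon : ∀ a b c u v w →
    a ∈ u → b ∈ u → c ∉ u → b ∈ v → c ∈ v → a ∉ v → c ∈ w → a ∈ w → b ∉ w → ⊥
  no-hexagon a b c u v w au bu cu bv cv av cw aw bw =
    chordal 3 3≤3+ (hexagon a b c u v w au bu cu bv cv av cw aw bw)

  no-octagon : ∀ a b c d u v w t →
    a ∈ u → b ∈ u → c ∉ u → d ∉ u → b ∈ v → c ∈ v → a ∉ v → d ∉ v →
    c ∈ w → d ∈ w → a ∉ w → b ∉ w → d ∈ t → a ∈ t → b ∉ t → c ∉ t → ⊥
  no-octagon a b c d u v w t au bu cu du bv cv av dv cw dw aw bw dt at bt ct =
    chordal 4 3≤3+ (octagon a b c d u v w t au bu cu du bv cv av dv cw dw aw bw dt at bt ct)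

  -- an induced matching a u, b v, c w is a hexagon of the mirror
  no-induced-3K₂ : ∀ a b c u v w →
    a ∈ u → b ∉ u → c ∉ u → b ∈ v → a ∉ v → c ∉ v → c ∈ w → a ∉ w → b ∉ w → ⊥
  no-induced-3K₂ a b c u v w au bu cu bv av cv cw aw bw =
    mirror-chordal 3 3≤3+ (hexagon {mir B} a b c w u v
      (cong not aw) (cong not bw) (cong not cw) (cong not bu) (cong not cu)
      (cong not au) (cong not cv) (cong not av) (cong not bv))

  between-trichotomy : ∀ a b c → Between a b c ⊎ Between b a c ⊎ Between a c b
  between-trichotomy a b c with between? a b c | between? b a c | between? a c b
  ... | yes abc | _ | _ = inj₁ abc
  ... | no _ | yes bac | _ = inj₂ (inj₁ bac)
  ... | no _ | no _ | yes acb = inj₂ (inj₂ acb)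
  ... | no ¬abc | no ¬bac | no ¬acb
    with w , a∈w , c∈w , b∉w ← ¬between-witness ¬abc
    with v , b∈v , c∈v , a∉v ← ¬between-witness ¬bac
    with u , a∈u , b∈u , c∉u ← ¬between-witness ¬acb
    = ⊥-elim (no-hexagon a b c u v w a∈u b∈u c∉u b∈v c∈v a∉v c∈w a∈w b∉w)

  between-common-neighbour : ∀ {a b c} → Between a b c → a ⊈ b → b ∥ c →
    Σ Y λ y → a ∈ y × b ∈ y × c ∉ y
  between-common-neighbour {a} {b} {c} abc a⊈b (b⊈c , c⊈b)
    with s , b∈s , c∉s ← private-neighbour b⊈c
    with E B a s in a∈?s
  ... | true = s , a∈?s , b∈s , c∉s
  ... | false
    with p , a∈p , b∉p ← private-neighbour a⊈b
    with q , c∈q , b∉q ← private-neighbour c⊈b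
    = ⊥-elim (no-induced-3K₂ a b c p s q a∈p b∉p (between-∉ abc a∈p b∉p)
                b∈s a∈?s c∉s c∈q (between-∉ (between-sym abc) c∈q b∉q) b∉q)

  between-unique : ∀ {a b c} → Between a b c → Between b a c → a ∥ b → c ⊈ a → ⊥
  between-unique {a} {b} {c} abc bac (a⊈b , b⊈a) c⊈a
    with t₁ , a∈t₁ , b∉t₁ ← private-neighbour a⊈b
    with t₂ , b∈t₂ , a∉t₂ ← private-neighbour b⊈a
    with t₃ , c∈t₃ , a∉t₃ ← private-neighbour c⊈a
    = no-induced-3K₂ a b c t₁ t₂ t₃ a∈t₁ b∉t₁ (between-∉ abc a∈t₁ b∉t₁)
        b∈t₂ a∉t₂ (between-∉ bac b∈t₂ a∉t₂)
        c∈t₃ a∉t₃ (between-∉ (between-sym bac) c∈t₃ a∉t₃)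

  between-glue : ∀ {a b c d} → Between a b c → Between b c d →
    a ∥ b → b ∥ c → d ⊈ c → Between a b d
  between-glue {a} {b} {c} {d} abc bcd a∥b b∥c d⊈c with between? a b d
  ... | yes abd = abd
  ... | no ¬abd
    with t , a∈t , d∈t , b∉t ← ¬between-witness ¬abd
    with u , a∈u , b∈u , c∉u ← between-common-neighbour abc (proj₁ a∥b) b∥c
    with w , d∈w , c∈w , b∉w ← between-common-neighbour (between-sym bcd) d⊈c (∥-sym b∥c)
    with v , c∈v , b∈v , a∉v ← between-common-neighbour (between-sym abc) (proj₂ b∥c) (∥-sym a∥b)
    with E B d v in d∈?v
  ... | false = ⊥-elim (no-octagon a b c d u v w t a∈u b∈u c∉u (between-∉ bcd b∈u c∉u) b∈v c∈v a∉v d∈?v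
                  c∈w d∈w (between-∉ (between-sym abc) c∈w b∉w) b∉w d∈t a∈t b∉t (between-∉ abc a∈t b∉t))
  ... | true = ⊥-elim (no-hexagon a b d u v t a∈u b∈u (between-∉ bcd b∈u c∉u) b∈v d∈?v a∉v d∈t a∈t b∉t)

  between-glue′ : ∀ {a b c d} → Between a b c → Between b c d →
    b ∥ c → c ∥ d → a ⊈ b → Between a c d
  between-glue′ abc bcd b∥c c∥d a⊈b =
    between-sym (between-glue (between-sym bcd) (between-sym abc) (∥-sym c∥d) (∥-sym b∥c) a⊈b)

  between-tail : ∀ {a b c d} → Between a b c → Between a c d →
    a ⊈ b → c ⊈ b → b ∥ d → c ∥ d → a ⊈ d → Between b c d
  between-tail {a} {b} {c} {d} abc acd a⊈b c⊈b b∥d c∥d a⊈d with between-trichotomy b c d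
  ... | inj₁ bcd = bcd
  ... | inj₂ (inj₁ cbd)
    with h , c∈h , b∉h ← private-neighbour c⊈b
    with t , a∈t , b∉t ← private-neighbour a⊈b
    with r , d∈r , c∉r ← private-neighbour (proj₂ c∥d)
    = ⊥-elim (no-induced-3K₂ a c d t h r
                a∈t (between-∉ abc a∈t b∉t) (between-∉ acd a∈t (between-∉ abc a∈t b∉t))
                c∈h (between-∉ (between-sym abc) c∈h b∉h) (between-∉ cbd c∈h b∉h)
                d∈r (between-∉ (between-sym acd) d∈r c∉r) c∉r)
  ... | inj₂ (inj₂ bdc) = ⊥-elim (between-unique (between-sym acd) (between-sym adc) (∥-sym c∥d) a⊈d)
    where
    adc : Between a d c
    adc = between-glue′ (between-trans abc acd) bdc b∥d (∥-sym c∥d) a⊈b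

-- Convex arrangements

module Insertion (B : BipGraph) (chordal : ChordalBip B) (mirror-chordal : ChordalBip (mir B)) where

  open Neighbourhoods B
  open ChordalBetweenness B chordal mirror-chordal

  Convex : ∀ {n} → Vector X n → Set
  Convex = Ordered Between

  module _ {t} {σ : Vector X (suc (suc t))} {z : X}
           (convex : Convex σ) (σ∥σ : Pairwise _∥_ σ) (z∥σ : ∀ i → z ∥ σ i) where

    private
      n : ℕ
      n = suc (suc t)
      last : Fin n
      last = fromℕ (suc t)
      first : Fin n
      first = zero

      <⊈> : ∀ {i j} → i Fin.< j → σ i ⊈ σ j
      <⊈> i<j = proj₁ (σ∥σ (<⇒≢ i<j))
      >⊈< : ∀ {i j} → i Fin.< j → σ j ⊈ σ i
      >⊈< i<j = proj₂ (σ∥σ (<⇒≢ i<j))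
      <∥> : ∀ {i j} → i Fin.< j → σ i ∥ σ j
      <∥> i<j = σ∥σ (<⇒≢ i<j)
      z⊈ : ∀ i → z ⊈ σ i
      z⊈ = proj₁ ∘ z∥σ
      ⊈z : ∀ i → σ i ⊈ z
      ⊈z = proj₂ ∘ z∥σ
      ∥z : ∀ i → σ i ∥ z
      ∥z = ∥-sym ∘ z∥σ

    fits-front : Between z (σ zero) (σ last) → Fits Between σ zero z
    fits-front z-σ₀-σₜ = record { before = λ _ (); across = λ (); after = after }
      where
      z-σ₀ : ∀ {l} → first Fin.< l → Between z (σ zero) (σ l)
      z-σ₀ {l} 0<l with ≤⇒≡⊎< (≤fromℕ l)
      ... | inj₁ refl = z-σ₀-σₜ
      ... | inj₂ l<last = between-sym (between-tail (between-sym (convex 0<l l<last)) (between-sym z-σ₀-σₜ)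
                            (>⊈< l<last) (<⊈> 0<l) (∥z l) (∥z zero) (⊈z last))
      after : ∀ {i l} → first Fin.≤ i → i Fin.< l → Between z (σ i) (σ l)
      after {zero} _ 0<l = z-σ₀ 0<l
      after {suc i} _ i<l = between-sym (between-trans (between-sym (convex (s≤s z≤n) i<l))
                              (between-sym (z-σ₀ (ℕ.<-trans (s≤s z≤n) i<l))))

    fits-back : Between (σ zero) (σ last) z → Fits Between σ (fromℕ n) z
    fits-back σ₀σ-σₜ-z = record { before = before ; across = λ _ → beyond ; after = beyond }
      where
      beyond : ∀ {l} {A : Set} → fromℕ n Fin.≤ l → A
      beyond {l} n≤l = ⊥-elim (ℕ.<⇒≱ (toℕ<n l) (subst (_≤ toℕ l) (toℕ-fromℕ n) n≤l))
      σ-σₜ-z : ∀ {i} → i Fin.< last → Between (σ i) (σ last) z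
      σ-σₜ-z {zero} _ = σ₀σ-σₜ-z
      σ-σₜ-z {suc i} i<last = between-tail (convex (s≤s z≤n) i<last) σ₀σ-σₜ-z
                               (<⊈> (s≤s z≤n)) (>⊈< i<last) (∥z (suc i)) (∥z last) (⊈z zero)
      before : ∀ {i l} → i Fin.< l → l Fin.< fromℕ n → Between (σ i) (σ l) z
      before {i} {l} i<l _ with ≤⇒≡⊎< (≤fromℕ l)
      ... | inj₁ refl = σ-σₜ-z i<l
      ... | inj₂ l<last = between-trans (convex i<l l<last) (σ-σₜ-z (ℕ.<-trans i<l l<last))

    -- z goes just before the first σ g, g > 0, that is not between σ₀ and z
    private
      Left : Fin n → Set
      Left i = i ≡ first ⊎ Between (σ first) (σ i) z

      module Middle (σ₀-z-σₜ : Between (σ first) z (σ last)) (g : Fin n)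
                    (¬left-g : ¬ Left g) (left-below : ∀ {i} → i Fin.< g → Left i) where

        0<g : first Fin.< g
        0<g = ≤∧≢⇒< z≤n λ 0≡g → ¬left-g (inj₁ (sym 0≡g))

        ¬σ₀-σ-z : ∀ {l} → g Fin.≤ l → ¬ Between (σ first) (σ l) z
        ¬σ₀-σ-z g≤l with ≤⇒≡⊎< g≤l
        ... | inj₁ refl = ¬left-g ∘ inj₂
        ... | inj₂ g<l = ¬left-g ∘ inj₂ ∘ between-trans (convex 0<g g<l)

        σ₀-z : ∀ {l} → g Fin.≤ l → Between (σ first) z (σ l)
        σ₀-z {l} g≤l with ≤⇒≡⊎< (≤fromℕ l)
        ... | inj₁ refl = σ₀-z-σₜ
        ... | inj₂ l<last with between-trichotomy (σ first) (σ l) z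
        ...   | inj₁ σ₀-σ-z = ⊥-elim (¬σ₀-σ-z g≤l σ₀-σ-z)
        ...   | inj₂ (inj₂ σ₀-z-σ) = σ₀-z-σ
        ...   | inj₂ (inj₁ σ-σ₀-z) =
          ⊥-elim (between-unique (between-glue σ-σ₀-z σ₀-z-σₜ (∥-sym (<∥> 0<l)) (∥z first) (⊈z last))
                    (convex 0<l l<last) (∥-sym (<∥> 0<l)) (>⊈< l<last))
          where
          0<l : first Fin.< l
          0<l = ℕ.<-≤-trans 0<g g≤l

        across : ∀ {i l} → i Fin.< g → g Fin.≤ l → Between (σ i) z (σ l)
        across {zero} _ g≤l = σ₀-z g≤l
        across {suc i} {l} i<g g≤l with left-below i<g
        ... | inj₂ σ₀-σ-z = between-tail σ₀-σ-z (σ₀-z g≤l) (<⊈> (s≤s z≤n)) (z⊈ (suc i))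
                              (<∥> (ℕ.<-≤-trans i<g g≤l)) (z∥σ l) (<⊈> (ℕ.<-≤-trans 0<g g≤l))

        before : ∀ {i l} → i Fin.< l → l Fin.< g → Between (σ i) (σ l) z
        before {i} {l} i<l l<g =
          between-sym (between-tail (between-sym (across l<g (≤fromℕ g))) (between-sym (convex i<l l<last))
            (⊈z last) (⊈z l) (z∥σ i) (∥-sym (<∥> i<l)) (>⊈< (ℕ.<-trans i<l l<last)))
          where
          l<last : l Fin.< last
          l<last = ℕ.<-≤-trans l<g (≤fromℕ g)

        after : ∀ {i l} → g Fin.≤ i → i Fin.< l → Between z (σ i) (σ l)
        after {i} {l} g≤i i<l =
          between-tail (across 0<g g≤i) (convex 0<i i<l)
            (⊈z first) (⊈z i) (z∥σ l) (<∥> i<l) (<⊈> (ℕ.<-trans 0<i i<l))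
          where
          0<i : first Fin.< i
          0<i = ℕ.<-≤-trans 0<g g≤i

        fits : Fits Between σ (inject₁ g) z
        fits = record
          { before = λ i<l l<g → before i<l (from-< l<g)
          ; across = λ i<g g≤l → across (from-< i<g) (subst (_≤ _) (toℕ-inject₁ g) g≤l)
          ; after  = λ g≤i i<l → after (subst (_≤ _) (toℕ-inject₁ g) g≤i) i<l
          }
          where
          from-< : ∀ {i} → toℕ i < toℕ (inject₁ g) → i Fin.< g
          from-< = subst (_ <_) (toℕ-inject₁ g)

    private
      left? : ∀ i → Dec (Left i)
      left? i = (i Fin.≟ first) ⊎-dec between? (σ first) (σ i) z

      ¬left-last : Between (σ first) z (σ last) → ¬ Left last
      ¬left-last σ₀-z-σₜ (inj₂ σ₀σ-σₜ-z) =
        between-unique (between-sym σ₀σ-σₜ-z) (between-sym σ₀-z-σₜ) (z∥σ last) (⊈z first)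

    fits-middle : Between (σ first) z (σ last) → Σ (Fin (suc n)) λ g → Fits Between σ g z
    fits-middle σ₀-z-σₜ
      with g , ¬left-g , left-below ← ¬∀⟶∃¬-smallest n Left left? (λ all → ¬left-last σ₀-z-σₜ (all last))
      = inject₁ g , Middle.fits σ₀-z-σₜ g ¬left-g left-below′
      where
      left-below′ : ∀ {i} → i Fin.< g → Left i
      left-below′ {i} i<g = subst Left (toℕ-injective (trans (toℕ-inject j) (toℕ-fromℕ< i<g))) (left-below j)
        where
        j : Fin (toℕ g)
        j = fromℕ< i<g

    fits-somewhere : Σ (Fin (suc n)) λ g → Fits Between σ g z
    fits-somewhere with between-trichotomy (σ first) z (σ last)
    ... | inj₁ σ₀-z-σₜ = fits-middle σ₀-z-σₜ
    ... | inj₂ (inj₁ z-σ₀-σₜ) = zero , fits-front z-σ₀-σₜ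
    ... | inj₂ (inj₂ σ₀σ-σₜ-z) = fromℕ n , fits-back σ₀σ-σₜ-z

  ConvexArrangement : ∀ {m} → Vector X m → Set
  ConvexArrangement {m} α =
    Σ (Vector X m) λ σ → Convex σ × Pairwise _∥_ σ × (∀ i → Σ (Fin m) λ j → σ i ≡ α j)

  private
    insert-head : ∀ {t} (α : Vector X (suc (suc (suc t)))) → Pairwise _∥_ α →
      ConvexArrangement (α ∘ suc) → ConvexArrangement α
    insert-head {t} α α∥α (σ , convex , σ∥σ , from-α) =
      insertAt σ g (α zero) , ordered-insertAt Between convex fits ,
      insertAt-pairwise {R = _∥_} g σ∥σ z∥σ (∥-sym ∘ z∥σ) , from-α′
      where
      z∥σ : ∀ i → α zero ∥ σ i
      z∥σ i with j , σi≡αj ← from-α i = subst (α zero ∥_) (sym σi≡αj) (α∥α λ ())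
      g : Fin (suc (suc (suc t)))
      g = proj₁ (fits-somewhere convex σ∥σ z∥σ)
      fits : Fits Between σ g (α zero)
      fits = proj₂ (fits-somewhere convex σ∥σ z∥σ)
      from-α′ : ∀ p → Σ (Fin (suc (suc (suc t)))) λ j → insertAt σ g (α zero) p ≡ α j
      from-α′ p with inserted g p
      ... | new = zero , insertAt-lookup σ g (α zero)
      ... | old r with j , σr≡αj ← from-α r = suc j , trans (insertAt-punchIn σ g (α zero) r) σr≡αj

  convex-arrangement : ∀ {m} (α : Vector X m) → Pairwise _∥_ α → ConvexArrangement α
  convex-arrangement {zero} α α∥α = α , ordered-short Between z≤n , α∥α , λ i → i , refl
  convex-arrangement {suc zero} α α∥α = α , ordered-short Between (s≤s z≤n) , α∥α , λ i → i , refl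
  convex-arrangement {suc (suc zero)} α α∥α =
    α , ordered-short Between (s≤s (s≤s z≤n)) , α∥α , λ i → i , refl
  convex-arrangement {suc (suc (suc t))} α α∥α =
    insert-head α α∥α (convex-arrangement (α ∘ suc) (λ i≢j → α∥α (i≢j ∘ suc-injective)))

module Embedding (B : BipGraph) (chordal : ChordalBip B) (mirror-chordal : ChordalBip (mir B)) where

  open Neighbourhoods B
  open ChordalBetweenness B chordal mirror-chordal
  open Insertion B chordal mirror-chordal using (Convex; convex-arrangement)

  module _ {w} {σ : Vector X (suc (suc w))} (convex : Convex σ) (σ∥σ : Pairwise _∥_ σ) where

    private
      m N : ℕ
      m = suc (suc w)
      N = nY (Bm m)

    convex-∈ : ∀ {a b i y} → σ a ∈ y → σ b ∈ y → a Fin.≤ i → i Fin.≤ b → σ i ∈ y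
    convex-∈ {y = y} a∈y b∈y a≤i i≤b with ≤⇒≡⊎< a≤i | ≤⇒≡⊎< i≤b
    ... | inj₁ refl | _ = a∈y
    ... | inj₂ _ | inj₁ refl = b∈y
    ... | inj₂ a<i | inj₂ i<b = convex a<i i<b y a∈y b∈y

    convex-∉-after : ∀ {a b i y} → σ a ∈ y → σ b ∉ y → a Fin.< b → b Fin.≤ i → σ i ∉ y
    convex-∉-after a∈y b∉y a<b b≤i with ≤⇒≡⊎< b≤i
    ... | inj₁ refl = b∉y
    ... | inj₂ b<i = between-∉ (convex a<b b<i) a∈y b∉y

    convex-∉-before : ∀ {a b i y} → σ b ∈ y → σ a ∉ y → a Fin.< b → i Fin.≤ a → σ i ∉ y
    convex-∉-before b∈y a∉y a<b i≤a with ≤⇒≡⊎< i≤a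
    ... | inj₁ refl = a∉y
    ... | inj₂ i<a = between-∉ (between-sym (convex i<a a<b)) b∈y a∉y

    neighbour-up-to : ∀ {c a b} → c Fin.≤ a → a Fin.< b → Σ Y λ y → σ c ∈ y × σ a ∈ y × σ b ∉ y
    neighbour-up-to c≤a a<b with ≤⇒≡⊎< c≤a
    ... | inj₁ refl with y , a∈y , b∉y ← private-neighbour (proj₁ (σ∥σ (<⇒≢ a<b))) = y , a∈y , a∈y , b∉y
    ... | inj₂ c<a = between-common-neighbour (convex c<a a<b) (proj₁ (σ∥σ (<⇒≢ c<a))) (σ∥σ (<⇒≢ a<b))

    neighbour-from : ∀ {a b c} → a Fin.< b → b Fin.≤ c → Σ Y λ y → σ c ∈ y × σ b ∈ y × σ a ∉ y
    neighbour-from a<b b≤c with ≤⇒≡⊎< b≤c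
    ... | inj₁ refl with y , b∈y , a∉y ← private-neighbour (proj₂ (σ∥σ (<⇒≢ a<b))) = y , b∈y , b∈y , a∉y
    ... | inj₂ b<c = between-common-neighbour (between-sym (convex a<b b<c))
                       (proj₂ (σ∥σ (<⇒≢ b<c))) (∥-sym (σ∥σ (<⇒≢ a<b)))

    prefix-neighbour : ∀ (J : Fin (suc w)) → Σ Y λ y → ∀ i → σ i ∈ y ⇔ i Fin.≤ J
    prefix-neighbour J
      with y , σ₀∈y , σJ∈y , σJ+1∉y ← neighbour-up-to {zero} {inject₁ J} {suc J} z≤n (≤̄⇒inject₁< ℕ.≤-refl)
      = y , λ i → mk⇔ (to i)
                  (λ i≤J → convex-∈ σ₀∈y σJ∈y z≤n (subst (toℕ i ≤_) (sym (toℕ-inject₁ J)) i≤J))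
      where
      to : ∀ i → σ i ∈ y → i Fin.≤ J
      to i σi∈y with toℕ i ≤? toℕ J
      ... | yes i≤J = i≤J
      ... | no i≰J =
        ⊥-elim (∈∉-clash σi∈y (convex-∉-after σJ∈y σJ+1∉y (≤̄⇒inject₁< ℕ.≤-refl) (ℕ.≰⇒> i≰J)))

    suffix-neighbour : ∀ (s : Fin (suc w)) → Σ Y λ y → ∀ i → σ i ∈ y ⇔ s Fin.< i
    suffix-neighbour s
      with y , σₘ∈y , σs+1∈y , σs∉y ←
             neighbour-from {inject₁ s} {suc s} {fromℕ (suc w)} (≤̄⇒inject₁< ℕ.≤-refl) (≤fromℕ (suc s))
      = y , λ i → mk⇔ (to i) (λ s<i → convex-∈ σs+1∈y σₘ∈y s<i (≤fromℕ i))
      where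
      to : ∀ i → σ i ∈ y → s Fin.< i
      to i σi∈y with toℕ s <? toℕ i
      ... | yes s<i = s<i
      ... | no s≮i = ⊥-elim (∈∉-clash σi∈y (convex-∉-before σs+1∈y σs∉y (≤̄⇒inject₁< ℕ.≤-refl)
                        (subst (toℕ i ≤_) (sym (toℕ-inject₁ s)) (ℕ.≮⇒≥ s≮i))))

    window-neighbour : ∀ J → J < N → Σ Y λ y → ∀ i → σ i ∈ y ⇔ Window w (toℕ i) J
    window-neighbour J J<N with cut w J
    ... | below J≤w with y , spec ← prefix-neighbour (fromℕ< (s≤s J≤w)) = y , λ i → mk⇔
      (λ σi∈y → let i≤J = subst (toℕ i ≤_) (toℕ-fromℕ< (s≤s J≤w)) (Equivalence.to (spec i) σi∈y)
                in i≤J , ℕ.≤-trans J≤w (ℕ.m≤n+m w (toℕ i)))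
      (λ (i≤J , _) → Equivalence.from (spec i) (subst (toℕ i ≤_) (sym (toℕ-fromℕ< (s≤s J≤w))) i≤J))
    ... | above s with y , spec ← suffix-neighbour (fromℕ< (s≤s (Bm-index-above w J<N))) = y , λ i → mk⇔
      (λ σi∈y → let s<i = subst (_< toℕ i) (toℕ-fromℕ< (s≤s (Bm-index-above w J<N))) (Equivalence.to (spec i) σi∈y)
                in ℕ.≤-trans (ℕ.≤-pred (toℕ<n i)) (s≤s (ℕ.m≤m+n w s)) ,
                   subst₂ _≤_ (ℕ.+-suc w s) (ℕ.+-comm w (toℕ i)) (ℕ.+-monoʳ-≤ w s<i))
      (λ (_ , J≤i+w) → Equivalence.from (spec i) (subst (_< toℕ i) (sym (toℕ-fromℕ< (s≤s (Bm-index-above w J<N))))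
         (ℕ.+-cancelˡ-≤ w (suc s) (toℕ i) (subst₂ _≤_ (sym (ℕ.+-suc w s)) (ℕ.+-comm (toℕ i) w) J≤i+w))))

    Bm-embedding : ContainsInduced (graphOf (Bm m)) (graphOf B)
    Bm-embedding = reflecting⇒containsInduced {G = graphOf B} (Bm-twinFree w) φ reflect
      where
      ψ : Fin N → Y
      ψ j = proj₁ (window-neighbour (toℕ j) (toℕ<n j))
      φ : Fin m ⊎ Fin N → X ⊎ Y
      φ (inj₁ i) = inj₁ (σ i)
      φ (inj₂ j) = inj₂ (ψ j)
      edge : ∀ i j → E (Bm m) i j ≡ true ⇔ σ i ∈ ψ j
      edge i j = ⇔-sym (proj₂ (window-neighbour (toℕ j) (toℕ<n j)) i) ⇔-∘ E-Bm⇔ m i j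
      reflect : ∀ u v → BAdj (Bm m) u v ⇔ BAdj B (φ u) (φ v)
      reflect (inj₁ _) (inj₁ _) = mk⇔ (λ ()) (λ ())
      reflect (inj₁ i) (inj₂ j) = edge i j
      reflect (inj₂ j) (inj₁ i) = edge i j
      reflect (inj₂ _) (inj₂ _) = mk⇔ (λ ()) (λ ())

  antichain⇒Bm : ∀ {w} (α : Vector X (suc (suc w))) → Pairwise _∥_ α →
    ContainsInduced (graphOf (Bm (suc (suc w)))) (graphOf B)
  antichain⇒Bm α α∥α with σ , convex , σ∥σ , _ ← convex-arrangement α α∥α = Bm-embedding convex σ∥σ

-- Induced copies of B_m

module InducedImage {H : Graph} (B : BipGraph) (φ : V H → Fin (nX B) ⊎ Fin (nY B))
                    (reflect : ∀ u v → Adj H u v ⇔ BAdj B (φ u) (φ v)) where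

  OnX OnY : V H → Set
  OnX u = Σ (Fin (nX B)) λ p → φ u ≡ inj₁ p
  OnY u = Σ (Fin (nY B)) λ q → φ u ≡ inj₂ q

  ¬OnX×OnY : ∀ {u} → OnX u → OnY u → ⊥
  ¬OnX×OnY (_ , φu≡p) (_ , φu≡q) with () ← trans (sym φu≡p) φu≡q

  opposite-sides : ∀ {u v} → Adj H u v → (OnX u × OnY v) ⊎ (OnY u × OnX v)
  opposite-sides {u} {v} uv with φ u | φ v | Equivalence.to (reflect u v) uv
  ... | inj₁ p | inj₂ q | _ = inj₁ ((p , refl) , (q , refl))
  ... | inj₂ q | inj₁ p | _ = inj₂ ((q , refl) , (p , refl))

  same-side : ∀ {u v w} → Adj H u w → Adj H v w → OnX u → OnX v
  same-side uw vw onX-u with opposite-sides uw | opposite-sides vw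
  ... | inj₁ (_ , onY-w) | inj₁ (onX-v , _) = onX-v
  ... | inj₁ (_ , onY-w) | inj₂ (_ , onX-w) = ⊥-elim (¬OnX×OnY onX-w onY-w)
  ... | inj₂ (onY-u , _) | _ = ⊥-elim (¬OnX×OnY onX-u onY-u)

  image-⊈ : ∀ {u v w p q} → φ u ≡ inj₁ p → φ v ≡ inj₁ q → Adj H u w → ¬ Adj H v w → ¬ NX⊆ B p q
  image-⊈ {u} {v} {w} φu≡ φv≡ uw ¬vw p⊆q
    with φ w in φw≡ | subst₂ (BAdj B) φu≡ refl (Equivalence.to (reflect u w) uw)
  ... | inj₂ y | p∈y = ¬vw (Equivalence.from (reflect v w) (subst₂ (BAdj B) (sym φv≡) (sym φw≡) (p⊆q y p∈y)))

  image-incomparable : ∀ {s} (u : Fin s → V H) (p : Fin s → Fin (nX B)) → (∀ i → φ (u i) ≡ inj₁ (p i)) →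
    (∀ {i j} → ¬ i ≡ j → Σ (V H) λ w → Adj H (u i) w × ¬ Adj H (u j) w) → IncompX B s p
  image-incomparable u p φu≡ separated = injective , incomparable
    where
    incomparable : ∀ i j → ¬ i ≡ j → ¬ NX⊆ B (p i) (p j)
    incomparable i j i≢j with w , uiw , ¬ujw ← separated i≢j = image-⊈ (φu≡ i) (φu≡ j) uiw ¬ujw
    injective : Injective _≡_ _≡_ p
    injective {i} {j} pi≡pj with i Fin.≟ j
    ... | yes i≡j = i≡j
    ... | no i≢j = ⊥-elim (incomparable i j i≢j (subst (NX⊆ B (p i)) pi≡pj λ _ p∈y → p∈y))

Bm-excluded : ∀ {B} w → ∇X≤ B (suc (suc w)) →
  (embedding : ContainsInduced (graphOf (Bm (suc (suc (suc w))))) (graphOf B)) →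
  Σ (Fin (nX B)) (λ p → proj₁ embedding (inj₁ (suc zero)) ≡ inj₁ p) → ⊥
Bm-excluded {B} w ∇X (φ , _ , reflect) onX₁ =
  ℕ.n≮n _ (∇X _ p (image-incomparable inj₁ p (proj₂ ∘ side) (Bm-x-separated (suc w))))
  where
  open InducedImage B φ reflect
  side : ∀ i → OnX (inj₁ i)
  side i with v , x₁v , xᵢv ← Bm-linked (suc w) (s≤s z≤n) i = same-side x₁v xᵢv onX₁
  p : Fin (suc (suc (suc w))) → Fin (nX B)
  p = proj₁ ∘ side

private
  component : Fin 2 ⊎ Fin 2 → Fin 2
  component (inj₁ i) = i
  component (inj₂ j) = j

  component-adj : ∀ u v → BAdj (Bm 2) u v → component u ≡ component v
  component-adj (inj₁ i) (inj₂ j) e with i≤j , j≤i+0 ← Equivalence.to (E-Bm⇔ 2 i j) e =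
    toℕ-injective (ℕ.≤-antisym i≤j (subst (toℕ j ≤_) (ℕ.+-identityʳ _) j≤i+0))
  component-adj (inj₂ j) (inj₁ i) e = sym (component-adj (inj₁ i) (inj₂ j) e)

2K₂-excluded : ∀ {B} → ∇X≤ B 1 → ¬ ContainsInduced (graphOf (Bm 2)) (graphOf B)
2K₂-excluded {B} ∇X (φ , _ , reflect) =
  ℕ.n≮n _ (∇X 2 p (image-incomparable (proj₁ ∘ endpoint) p (proj₂ ∘ onX) separated))
  where
  open InducedImage B φ reflect
  rung : ∀ i → BAdj (Bm 2) (inj₁ i) (inj₂ i)
  rung i = Equivalence.from (E-Bm⇔ 2 i i) (ℕ.≤-refl , ℕ.m≤m+n _ 0)
  endpoint : ∀ i → Σ (Fin 2 ⊎ Fin 2) λ u → Σ (Fin 2 ⊎ Fin 2) λ t →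
    BAdj (Bm 2) u t × OnX u × component u ≡ i × component t ≡ i
  endpoint i with opposite-sides (rung i)
  ... | inj₁ (onX , _) = inj₁ i , inj₂ i , rung i , onX , refl , refl
  ... | inj₂ (_ , onX) = inj₂ i , inj₁ i , rung i , onX , refl , refl
  onX : ∀ i → OnX (proj₁ (endpoint i))
  onX i = proj₁ (proj₂ (proj₂ (proj₂ (endpoint i))))
  p : Fin 2 → Fin (nX B)
  p = proj₁ ∘ onX
  separated : ∀ {i j} → ¬ i ≡ j →
    Σ (Fin 2 ⊎ Fin 2) λ w → BAdj (Bm 2) (proj₁ (endpoint i)) w × ¬ BAdj (Bm 2) (proj₁ (endpoint j)) w
  separated {i} {j} i≢j with u , t , ut , _ , ui , ti ← endpoint i | u′ , _ , _ , _ , uj , _ ← endpoint j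
    = t , ut , λ u′t → i≢j (trans (sym ti) (trans (sym (component-adj u′ t u′t)) uj))

bipDilw≤⇒Bm-free : ∀ k → 1 ≤ k → ∀ B → BipDilw≤ B k → ¬ ContainsInduced (graphOf (Bm (suc k))) (graphOf B)
bipDilw≤⇒Bm-free (suc zero) _ B (∇X , _) = 2K₂-excluded ∇X
bipDilw≤⇒Bm-free (suc (suc w)) _ B (∇X , ∇Y) embedding with proj₁ embedding (inj₁ (suc zero)) in φx₁≡
... | inj₁ p = Bm-excluded w ∇X embedding (p , φx₁≡)
... | inj₂ q = Bm-excluded w ∇Y (containsInduced-transpose (transpose B) embedding) (q , cong swap φx₁≡)

Bm-free⇒∇X≤ : ∀ B → ChordalBip B → ChordalBip (mir B) →
  ∀ w → ¬ ContainsInduced (graphOf (Bm (suc (suc w)))) (graphOf B) → ∇X≤ B (suc w)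
Bm-free⇒∇X≤ B chordal mirror-chordal w Bm-free s a (_ , incomparable) with s ≤? suc w
... | yes s≤k = s≤k
... | no s≰k = ⊥-elim (Bm-free (antichain⇒Bm α α∥α))
  where
  open Neighbourhoods B
  open Embedding B chordal mirror-chordal
  α : Vector X (suc (suc w))
  α i = a (inject≤ i (ℕ.≰⇒> s≰k))
  α∥α : Pairwise _∥_ α
  α∥α i≢j = incomparable _ _ (i≢j ∘ inject≤-injective _ _ _ _) ,
            incomparable _ _ (i≢j ∘ sym ∘ inject≤-injective _ _ _ _)

corollary8 : (k : ℕ) → 1 ≤ k → (B : BipGraph) → ACB B →
    (BipDilw≤ B k ⇔ (¬ ContainsInduced (graphOf (Bm (suc k))) (graphOf B)))
corollary8 (suc w) 1≤k B (chordal , mirror-chordal) = mk⇔ (bipDilw≤⇒Bm-free (suc w) 1≤k B) λ Bm-free →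
  Bm-free⇒∇X≤ B chordal mirror-chordal w Bm-free ,
  Bm-free⇒∇X≤ (transpose B) (chordal-transpose B chordal) (chordal-transpose (mir B) mirror-chordal) w
    (Bm-free ∘ containsInduced-transpose B)
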